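{- Let $\Gamma=\mathrm{Cay}(G,S)$ be a connected Cayley graph on the generalized dihedral group $G$ with $S\subseteq G\setminus\{e\}$ inverse-closed and $|S|=4$. If $|S\cap tA|=3$, then $\Gamma$ does not admit a perfect code.
   Context: $A$ is a finite abelian group and $G$ is a finite group containing $A$ as a subgroup of index $2$, together with an involution $t\in G\setminus A$ such that $tat=a^{ -1}$ for all $a\in A$; $tA=\{ta:a\in A\}$. $\mathrm{Cay}(G,S)$ has vertex set $G$, with $x,y$ adjacent iff $yx^{ -1}\in S$. A set $D$ of vertices is a perfect code if every vertex $x$ has exactly one element of $D$ in $\{x\}\cup N(x)$, where $N(x)$ is the neighbourhood of $x$. -}

module Defs where

open import Level using (0ℓ)
open import Algebra.Bundles using (Group)
open import Data.Nat using (ℕ)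
open import Data.List using (List; length)
open import Data.List.Relation.Unary.All using (All)
open import Data.List.Relation.Unary.Any using (Any)
open import Data.List.Relation.Unary.AllPairs using (AllPairs)
open import Data.Product using (Σ; ∃; _×_; _,_)
open import Data.Sum using (_⊎_)
open import Data.Unit using (⊤)
open import Relation.Nullary using (¬_)
open import Relation.Binary.PropositionalEquality using (_≡_)

module _ (G : Group 0ℓ 0ℓ) where
  open Group G renaming (Carrier to X)

  _∈≈_ : X → List X → Set
  x ∈≈ xs = Any (x ≈_) xs

  HasSize : (X → Set) → ℕ → Set
  HasSize P n = Σ (List X) λ xs →
    (length xs ≡ n) × AllPairs (λ x y → ¬ (x ≈ y)) xs × All P xs × (∀ x → P x → x ∈≈ xs)

  IsFinite : Set
  IsFinite = ∃ λ n → HasSize (λ _ → ⊤) n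

  record IsSubgroup (A : X → Set) : Set where
    field
      resp   : ∀ {x y} → x ≈ y → A x → A y
      has-ε  : A ε
      closed : ∀ {x y} → A x → A y → A (x ∙ y)
      inv    : ∀ {x} → A x → A (x ⁻¹)

  Coset : X → (X → Set) → X → Set
  Coset t A g = ∃ λ a → A a × (g ≈ t ∙ a)

  record IsGenDihedral (A : X → Set) (t : X) : Set where
    field
      subgroup  : IsSubgroup A
      abelian   : ∀ {a b} → A a → A b → a ∙ b ≈ b ∙ a
      t∉A       : ¬ A t
      index2    : ∀ g → A g ⊎ Coset t A g
      t-invol   : t ∙ t ≈ ε
      t-inverts : ∀ {a} → A a → (t ∙ a) ∙ t ≈ a ⁻¹

  Adj : (X → Set) → X → X → Set
  Adj S x y = S (y ∙ x ⁻¹)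

  data Reach (S : X → Set) : X → X → Set where
    here : ∀ {x y} → x ≈ y → Reach S x y
    step : ∀ {x y z} → Adj S x y → Reach S y z → Reach S x z

  Connected : (X → Set) → Set
  Connected S = ∀ x y → Reach S x y

  InverseClosed : (X → Set) → Set
  InverseClosed S = ∀ {s} → S s → S (s ⁻¹)

  ClosedNbhd : (X → Set) → X → X → Set
  ClosedNbhd S x d = (d ≈ x) ⊎ Adj S x d

  IsPerfectCode : (X → Set) → (X → Set) → Set
  IsPerfectCode S D = ∀ x →
    Σ X λ d → (D d × ClosedNbhd S x d) ×
      (∀ d' → D d' → ClosedNbhd S x d' → d' ≈ d)

  _∩_ : (X → Set) → (X → Set) → X → Set
  (P ∩ Q) x = P x × Q x

-- Write S = {a, s₀, s₁, s₂} with a ∈ A and sᵢ ∈ tA. Counting forces a to be the only element of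
-- S in A, so a is an involution; it commutes with every sᵢ, the sᵢ are involutions, and
-- sᵢ sⱼ sₖ = sₖ sⱼ sᵢ. Right translation is a graph automorphism, so a perfect code C may be
-- assumed to contain e. Then C ∪ aC contains no sᵢ-edge, and the vertex a sᵢ is dominated by some
-- a sₖ sᵢ ∈ C with k ≠ i. Following these partners through {0, 1, 2} gives distinct i, k, j with
-- a sₖ sᵢ ∈ C and a sⱼ sₖ ∈ C. Dominating v = sⱼ sᵢ and a v forces sₖ v ∈ C ∪ aC, but its
-- sᵢ-neighbour sᵢ sₖ v = sⱼ sₖ lies in C ∪ aC as well.
module Submission where

open import Defs
open import Level using (0ℓ)
open import Algebra.Bundles using (Group)
open import Data.Empty using (⊥; ⊥-elim)
open import Data.Fin using (Fin; zero; suc; punchOut)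
open import Data.Fin.Properties using (_≟_; all?; any?; injective⇒≤; punchOut-injective)
open import Data.List using (lookup)
open import Data.List.Membership.Propositional.Properties using (∈-lookup)
open import Data.List.Relation.Unary.All as All using ()
open import Data.List.Relation.Unary.AllPairs using (AllPairs; _∷_)
open import Data.List.Relation.Unary.Any using (index)
open import Data.List.Relation.Unary.Any.Properties using (lookup-index)
open import Data.Nat using (ℕ; _≤_)
open import Data.Nat.Properties using (n≮n)
open import Data.Product using (Σ; ∃; _×_; _,_; proj₁; proj₂)
open import Data.Sum using (_⊎_; inj₁; inj₂; [_,_])
open import Function using (_∘_)
open import Function.Definitions using (Injective)
open import Relation.Nullary using (¬_; yes; no; contradiction)
open import Relation.Nullary.Decidable using (toWitness; _→-dec_; _⊎-dec_; ¬?)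
open import Relation.Binary.PropositionalEquality as ≡ using (_≡_; _≢_; cong)

∃⊎∀ : ∀ {n} {P Q : Fin n → Set} → (∀ i → P i ⊎ Q i) → ∃ P ⊎ (∀ i → Q i)
∃⊎∀ {ℕ.zero} _ = inj₂ λ ()
∃⊎∀ {ℕ.suc n} P⊎Q with P⊎Q zero | ∃⊎∀ (λ i → P⊎Q (suc i))
... | inj₁ p | _ = inj₁ (zero , p)
... | inj₂ _ | inj₁ (i , p) = inj₁ (suc i , p)
... | inj₂ q | inj₂ qs = inj₂ λ { zero → q ; (suc i) → qs i }

injective⇒surjective : ∀ {n} {h : Fin n → Fin n} → Injective _≡_ _≡_ h → ∀ p → ∃ λ q → h q ≡ p
injective⇒surjective {ℕ.suc n} {h} h-injective p with any? (λ q → h q ≟ p)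
... | yes hit = hit
... | no miss = contradiction (injective⇒≤ {f = h′} h′-injective) (n≮n n)
  where
  h′ : Fin (ℕ.suc n) → Fin n
  h′ q = punchOut {i = p} {j = h q} λ p≡hq → miss (q , ≡.sym p≡hq)

  h′-injective : Injective _≡_ _≡_ h′
  h′-injective {q} {q′} eq = h-injective (punchOut-injective {i = p} {j = h q} {k = h q′} _ _ eq)

Fin3-cover : ∀ (i k j m : Fin 3) → k ≢ i → j ≢ k → j ≢ i → m ≡ i ⊎ m ≡ k ⊎ m ≡ j
Fin3-cover = toWitness {a? = all? λ i → all? λ k → all? λ j → all? λ m →
  ¬? (k ≟ i) →-dec ¬? (j ≟ k) →-dec ¬? (j ≟ i) →-dec (m ≟ i ⊎-dec m ≟ k ⊎-dec m ≟ j)} _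

Fin3-path : {R : Fin 3 → Fin 3 → Set} → (∀ i → ∃ λ k → k ≢ i × R i k) →
            ∃ λ i → ∃ λ k → ∃ λ j → k ≢ i × j ≢ k × j ≢ i × R i k × R k j
Fin3-path out with out zero
... | zero , 0≢0 , _ = ⊥-elim (0≢0 ≡.refl)
... | suc zero , _ , R01 with out (suc zero)
...   | suc zero , 1≢1 , _ = ⊥-elim (1≢1 ≡.refl)
...   | suc (suc zero) , _ , R12 = zero , suc zero , suc (suc zero) , (λ ()) , (λ ()) , (λ ()) , R01 , R12
...   | zero , _ , R10 with out (suc (suc zero))
...     | suc (suc zero) , 2≢2 , _ = ⊥-elim (2≢2 ≡.refl)
...     | zero , _ , R20 = suc (suc zero) , zero , suc zero , (λ ()) , (λ ()) , (λ ()) , R20 , R01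
...     | suc zero , _ , R21 = suc (suc zero) , suc zero , zero , (λ ()) , (λ ()) , (λ ()) , R21 , R10
Fin3-path out | suc (suc zero) , _ , R02 with out (suc (suc zero))
...   | suc (suc zero) , 2≢2 , _ = ⊥-elim (2≢2 ≡.refl)
...   | suc zero , _ , R21 = zero , suc (suc zero) , suc zero , (λ ()) , (λ ()) , (λ ()) , R02 , R21
...   | zero , _ , R20 with out (suc zero)
...     | suc zero , 1≢1 , _ = ⊥-elim (1≢1 ≡.refl)
...     | zero , _ , R10 = suc zero , zero , suc (suc zero) , (λ ()) , (λ ()) , (λ ()) , R10 , R02
...     | suc (suc zero) , _ , R12 = suc zero , suc (suc zero) , zero , (λ ()) , (λ ()) , (λ ()) , R12 , R20

module Enumerations (G : Group 0ℓ 0ℓ) where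
  open Group G renaming (Carrier to X)
  open import Relation.Binary.Reasoning.Setoid setoid

  record Enumeration (P : X → Set) (n : ℕ) : Set where
    field
      elem            : Fin n → X
      elem-∈          : ∀ i → P (elem i)
      elem-injective  : ∀ {i j} → elem i ≈ elem j → i ≡ j
      elem-surjective : ∀ {x} → P x → ∃ λ i → x ≈ elem i

    position : ∀ {x} → P x → Fin n
    position Px = proj₁ (elem-surjective Px)

    ≈-elem-position : ∀ {x} (Px : P x) → x ≈ elem (position Px)
    ≈-elem-position Px = proj₂ (elem-surjective Px)

    positions-injective : ∀ {m} {e : Fin m → X} (e-∈ : ∀ i → P (e i)) →
                          (∀ {i j} → e i ≈ e j → i ≡ j) → Injective _≡_ _≡_ (λ i → position (e-∈ i))
    positions-injective e-∈ e-injective {i} {j} eq = e-injective (begin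
      _                       ≈⟨ ≈-elem-position (e-∈ i) ⟩
      elem (position (e-∈ i)) ≡⟨ cong elem eq ⟩
      elem (position (e-∈ j)) ≈⟨ ≈-elem-position (e-∈ j) ⟨
      _                       ∎)

  open Enumeration

  lookup-injective : ∀ {xs} → AllPairs (λ x y → ¬ x ≈ y) xs → ∀ {i j} → lookup xs i ≈ lookup xs j → i ≡ j
  lookup-injective (_ ∷ _)       {zero}  {zero}  _  = ≡.refl
  lookup-injective (x≉xs ∷ _)    {zero}  {suc j} eq = ⊥-elim (All.lookup x≉xs (∈-lookup j) eq)
  lookup-injective (x≉xs ∷ _)    {suc i} {zero}  eq = ⊥-elim (All.lookup x≉xs (∈-lookup i) (sym eq))
  lookup-injective (_ ∷ xs-uniq) {suc i} {suc j} eq = cong suc (lookup-injective xs-uniq eq)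

  hasSize⇒enumeration : ∀ {P n} → HasSize G P n → Enumeration P n
  hasSize⇒enumeration (xs , ≡.refl , xs-uniq , xs-∈ , xs-complete) = record
    { elem            = lookup xs
    ; elem-∈          = λ i → All.lookup xs-∈ (∈-lookup i)
    ; elem-injective  = lookup-injective xs-uniq
    ; elem-surjective = λ {x} Px → index (xs-complete x Px) , lookup-index (xs-complete x Px)
    }

  enumeration-≤ : ∀ {P Q m n} → Enumeration P m → Enumeration Q n → (∀ {x} → P x → Q x) → m ≤ n
  enumeration-≤ EP EQ P⊆Q =
    injective⇒≤ (positions-injective EQ (λ i → P⊆Q (elem-∈ EP i)) (elem-injective EP))

  injective-exhausts : ∀ {P n} → Enumeration P n → (e : Fin n → X) → (e-∈ : ∀ i → P (e i)) →
                       (∀ {i j} → e i ≈ e j → i ≡ j) → ∀ {x} → P x → ∃ λ i → x ≈ e i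
  injective-exhausts E e e-∈ e-injective {x} Px
    with q , q↦p ← injective⇒surjective (positions-injective E e-∈ e-injective) (position E Px) =
    q , (begin
      x                           ≈⟨ ≈-elem-position E Px ⟩
      elem E (position E Px)      ≡⟨ cong (elem E) q↦p ⟨
      elem E (position E (e-∈ q)) ≈⟨ ≈-elem-position E (e-∈ q) ⟨
      e q                         ∎)

module CayleyGraph (G : Group 0ℓ 0ℓ) (S : Group.Carrier G → Set)
                   (S-resp : ∀ {x y} → Group._≈_ G x y → S x → S y) where
  open Group G renaming (Carrier to X)
  open import Algebra.Properties.Group G
    using (//-cong₂; //-rightDividesˡ; //-rightDividesʳ; x≈z//y; identityˡ-unique; ∙-cancelʳ; ⁻¹-anti-homo-∙)
  open import Algebra.Properties.Monoid monoid using (cancelᶜ)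
  open import Relation.Binary.Reasoning.Setoid setoid

  closedNbhd-resp : ∀ {x x′ y y′} → x ≈ x′ → y ≈ y′ → ClosedNbhd G S x y → ClosedNbhd G S x′ y′
  closedNbhd-resp x≈x′ y≈y′ (inj₁ y≈x) = inj₁ (trans (sym y≈y′) (trans y≈x x≈x′))
  closedNbhd-resp x≈x′ y≈y′ (inj₂ y~x) = inj₂ (S-resp (//-cong₂ y≈y′ x≈x′) y~x)

  closedNbhd-mul : ∀ {c x} → S c → ClosedNbhd G S x (c ∙ x)
  closedNbhd-mul {c} {x} Sc = inj₂ (S-resp (sym (//-rightDividesʳ x c)) Sc)

  closedNbhd-∙ʳ : ∀ {x y} g → ClosedNbhd G S x y → ClosedNbhd G S (x ∙ g) (y ∙ g)
  closedNbhd-∙ʳ g (inj₁ y≈x) = inj₁ (∙-congʳ y≈x)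
  closedNbhd-∙ʳ {x} {y} g (inj₂ y~x) = inj₂ (S-resp (sym quotient-invariant) y~x)
    where
    quotient-invariant : (y ∙ g) // (x ∙ g) ≈ y // x
    quotient-invariant = begin
      (y ∙ g) ∙ (x ∙ g) ⁻¹    ≈⟨ ∙-congˡ (⁻¹-anti-homo-∙ x g) ⟩
      (y ∙ g) ∙ (g ⁻¹ ∙ x ⁻¹) ≈⟨ cancelᶜ (inverseʳ g) y (x ⁻¹) ⟩
      y ∙ x ⁻¹                ∎

  -- The right translate D g⁻¹, closed under ≈ because D itself need not be.
  Translate : (X → Set) → X → X → Set
  Translate D g y = ∃ λ z → D z × z ≈ y ∙ g

  translate-resp : ∀ {D g x y} → x ≈ y → Translate D g x → Translate D g y
  translate-resp x≈y (z , Dz , z≈xg) = z , Dz , trans z≈xg (∙-congʳ x≈y)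

  translate-perfect : ∀ {D} → IsPerfectCode G S D → ∀ g → IsPerfectCode G S (Translate D g)
  translate-perfect {D} perfect g x with perfect (x ∙ g)
  ... | d , (Dd , d∈N[xg]) , unique = d // g , (d//g∈ , d//g∈N[x]) , only-d//g
    where
    d//g∈ : Translate D g (d // g)
    d//g∈ = d , Dd , sym (//-rightDividesˡ g d)

    d//g∈N[x] : ClosedNbhd G S x (d // g)
    d//g∈N[x] = closedNbhd-resp (//-rightDividesʳ g x) refl (closedNbhd-∙ʳ (g ⁻¹) d∈N[xg])

    only-d//g : ∀ d′ → Translate D g d′ → ClosedNbhd G S x d′ → d′ ≈ d // g
    only-d//g d′ (z , Dz , z≈d′g) d′∈N[x] = x≈z//y d′ g d (trans (sym z≈d′g) (unique z Dz z∈N[xg]))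
      where
      z∈N[xg] : ClosedNbhd G S (x ∙ g) z
      z∈N[xg] = closedNbhd-resp refl (sym z≈d′g) (closedNbhd-∙ʳ g d′∈N[x])

  module Code (C : X → Set) (C-resp : ∀ {x y} → x ≈ y → C x → C y) (perfect : IsPerfectCode G S C) where

    code-unique : ∀ {x y y′} → C y → C y′ → ClosedNbhd G S x y → ClosedNbhd G S x y′ → y ≈ y′
    code-unique {x} Cy Cy′ y∈N y′∈N with _ , _ , unique ← perfect x =
      trans (unique _ Cy y∈N) (sym (unique _ Cy′ y′∈N))

    code-independent : ¬ S ε → ∀ {x c} → C x → S c → ¬ C (c ∙ x)
    code-independent ε∉S {x} {c} Cx Sc Ccx =
      ε∉S (S-resp (identityˡ-unique c x (sym (code-unique Cx Ccx (inj₁ refl) (closedNbhd-mul Sc)))) Sc)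

    code-unique-neighbour : ∀ {x c c′} → C (c ∙ x) → C (c′ ∙ x) → S c → S c′ → c ≈ c′
    code-unique-neighbour {x} {c} {c′} Ccx Cc′x Sc Sc′ =
      ∙-cancelʳ x c c′ (code-unique Ccx Cc′x (closedNbhd-mul Sc) (closedNbhd-mul Sc′))

    dominated : ∀ x → C x ⊎ ∃ λ c → S c × C (c ∙ x)
    dominated x with perfect x
    ... | d , (Cd , inj₁ d≈x) , _ = inj₁ (C-resp d≈x Cd)
    ... | d , (Cd , inj₂ d~x) , _ = inj₂ (d // x , d~x , C-resp (sym (//-rightDividesˡ x d)) Cd)

module GenDihedral (G : Group 0ℓ 0ℓ) (A : Group.Carrier G → Set) (t : Group.Carrier G)
                   (dihedral : IsGenDihedral G A t) where
  open Group G renaming (Carrier to X)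
  open IsGenDihedral dihedral
  open IsSubgroup subgroup
  open import Algebra.Properties.Group G using (x≈z//y; inverseˡ-unique; ⁻¹-anti-homo-∙)
  open import Relation.Binary.Reasoning.Setoid setoid

  tA : X → Set
  tA = Coset G t A

  coset-resp : ∀ {x y} → x ≈ y → tA x → tA y
  coset-resp x≈y (b , Ab , x≈tb) = b , Ab , trans (sym x≈y) x≈tb

  A-disjoint-coset : ∀ {g} → A g → ¬ tA g
  A-disjoint-coset {g} Ag (b , Ab , g≈tb) =
    t∉A (resp (sym (x≈z//y t b g (sym g≈tb))) (closed Ag (inv Ab)))

  ∙-t : ∀ {x} → A x → x ∙ t ≈ t ∙ x ⁻¹
  ∙-t {x} Ax = begin
    x ∙ t             ≈⟨ identityˡ _ ⟨
    ε ∙ (x ∙ t)       ≈⟨ ∙-congʳ t-invol ⟨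
    (t ∙ t) ∙ (x ∙ t) ≈⟨ assoc t t _ ⟩
    t ∙ (t ∙ (x ∙ t)) ≈⟨ ∙-congˡ (assoc t x t) ⟨
    t ∙ ((t ∙ x) ∙ t) ≈⟨ ∙-congˡ (t-inverts Ax) ⟩
    t ∙ x ⁻¹          ∎

  coset-∙-coset : ∀ {x y} → tA x → tA y → A (x ∙ y)
  coset-∙-coset {x} {y} (b , Ab , x≈tb) (c , Ac , y≈tc) = resp (sym xy≈b⁻¹c) (closed (inv Ab) Ac)
    where
    xy≈b⁻¹c : x ∙ y ≈ b ⁻¹ ∙ c
    xy≈b⁻¹c = begin
      x ∙ y             ≈⟨ ∙-cong x≈tb y≈tc ⟩
      (t ∙ b) ∙ (t ∙ c) ≈⟨ assoc _ t c ⟨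
      ((t ∙ b) ∙ t) ∙ c ≈⟨ ∙-congʳ (t-inverts Ab) ⟩
      b ⁻¹ ∙ c          ∎

  A-∙-coset : ∀ {c z} → A c → tA z → tA (c ∙ z)
  A-∙-coset {c} {z} Ac (b , Ab , z≈tb) = c ⁻¹ ∙ b , closed (inv Ac) Ab , (begin
    c ∙ z           ≈⟨ ∙-congˡ z≈tb ⟩
    c ∙ (t ∙ b)     ≈⟨ assoc c t b ⟨
    (c ∙ t) ∙ b     ≈⟨ ∙-congʳ (∙-t Ac) ⟩
    (t ∙ c ⁻¹) ∙ b  ≈⟨ assoc t _ b ⟩
    t ∙ (c ⁻¹ ∙ b)  ∎)

  coset-involutive : ∀ {g} → tA g → g ∙ g ≈ ε
  coset-involutive {g} (b , Ab , g≈tb) = begin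
    g ∙ g             ≈⟨ ∙-cong g≈tb g≈tb ⟩
    (t ∙ b) ∙ (t ∙ b) ≈⟨ assoc _ t b ⟨
    ((t ∙ b) ∙ t) ∙ b ≈⟨ ∙-congʳ (t-inverts Ab) ⟩
    b ⁻¹ ∙ b          ≈⟨ inverseˡ b ⟩
    ε                 ∎

  coset-reverse : ∀ {x y z} → tA x → tA y → tA z → x ∙ (y ∙ z) ≈ z ∙ (y ∙ x)
  coset-reverse {x} {y} {z} tAx tAy tAz = begin
    x ∙ (y ∙ z)            ≈⟨ self-inverse tA[xyz] ⟩
    (x ∙ (y ∙ z)) ⁻¹       ≈⟨ ⁻¹-anti-homo-∙ x _ ⟩
    (y ∙ z) ⁻¹ ∙ x ⁻¹      ≈⟨ ∙-congʳ (⁻¹-anti-homo-∙ y z) ⟩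
    (z ⁻¹ ∙ y ⁻¹) ∙ x ⁻¹   ≈⟨ ∙-cong (∙-cong (self-inverse tAz) (self-inverse tAy)) (self-inverse tAx) ⟨
    (z ∙ y) ∙ x            ≈⟨ assoc z y x ⟩
    z ∙ (y ∙ x)            ∎
    where
    tA[xyz] : tA (x ∙ (y ∙ z))
    tA[xyz] = coset-resp (assoc x y z) (A-∙-coset (coset-∙-coset tAx tAy) tAz)

    self-inverse : ∀ {g} → tA g → g ≈ g ⁻¹
    self-inverse tAg = inverseˡ-unique _ _ (coset-involutive tAg)

  involution-centralises-coset : ∀ {a g} → A a → a ∙ a ≈ ε → tA g → a ∙ g ≈ g ∙ a
  involution-centralises-coset {a} {g} Aa aa≈ε (b , Ab , g≈tb) = begin
    a ∙ g           ≈⟨ ∙-congˡ g≈tb ⟩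
    a ∙ (t ∙ b)     ≈⟨ assoc a t b ⟨
    (a ∙ t) ∙ b     ≈⟨ ∙-congʳ (∙-t Aa) ⟩
    (t ∙ a ⁻¹) ∙ b  ≈⟨ ∙-congʳ (∙-congˡ (inverseˡ-unique a a aa≈ε)) ⟨
    (t ∙ a) ∙ b     ≈⟨ assoc t a b ⟩
    t ∙ (a ∙ b)     ≈⟨ ∙-congˡ (abelian Aa Ab) ⟩
    t ∙ (b ∙ a)     ≈⟨ assoc t b a ⟨
    (t ∙ b) ∙ a     ≈⟨ ∙-congʳ g≈tb ⟨
    g ∙ a           ∎

  module ConnectionSet (S : X → Set) (S-inverse : InverseClosed G S)
                       (S-size : HasSize G S 4) (S∩tA-size : HasSize G (_∩_ G S tA) 3) where
    open Enumerations G
    open Enumeration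

    private
      S-enum : Enumeration S 4
      S-enum = hasSize⇒enumeration S-size

      S∩tA-enum : Enumeration (_∩_ G S tA) 3
      S∩tA-enum = hasSize⇒enumeration S∩tA-size

    s : Fin 3 → X
    s = elem S∩tA-enum

    S-s : ∀ i → S (s i)
    S-s i = proj₁ (elem-∈ S∩tA-enum i)

    tA-s : ∀ i → tA (s i)
    tA-s i = proj₂ (elem-∈ S∩tA-enum i)

    s-injective : ∀ {i j} → s i ≈ s j → i ≡ j
    s-injective = elem-injective S∩tA-enum

    S∩A-element : ∃ λ a → S a × A a
    S∩A-element with ∃⊎∀ (λ i → index2 (elem S-enum i))
    ... | inj₁ (i , A-i) = elem S-enum i , elem-∈ S-enum i , A-i
    ... | inj₂ all-tA = contradiction (enumeration-≤ S-enum S∩tA-enum S⊆S∩tA) (n≮n 3)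
      where
      S⊆S∩tA : ∀ {x} → S x → _∩_ G S tA x
      S⊆S∩tA Sx = Sx , coset-resp (sym (≈-elem-position S-enum Sx)) (all-tA (position S-enum Sx))

    a : X
    a = proj₁ S∩A-element

    S-a : S a
    S-a = proj₁ (proj₂ S∩A-element)

    A-a : A a
    A-a = proj₂ (proj₂ S∩A-element)

    a≉s : ∀ i → ¬ a ≈ s i
    a≉s i a≈s = A-disjoint-coset A-a (coset-resp (sym a≈s) (tA-s i))

    private
      generators : Fin 4 → X
      generators zero    = a
      generators (suc m) = s m

      generators-∈ : ∀ i → S (generators i)
      generators-∈ zero    = S-a
      generators-∈ (suc m) = S-s m

      generators-injective : ∀ {i j} → generators i ≈ generators j → i ≡ j
      generators-injective {zero}  {zero}  _   = ≡.refl
      generators-injective {zero}  {suc m} a≈s = ⊥-elim (a≉s m a≈s)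
      generators-injective {suc m} {zero}  s≈a = ⊥-elim (a≉s m (sym s≈a))
      generators-injective {suc m} {suc n} s≈s = cong suc (s-injective s≈s)

    S-cover : ∀ {c} → S c → c ≈ a ⊎ ∃ λ m → c ≈ s m
    S-cover Sc with injective-exhausts S-enum generators generators-∈ generators-injective Sc
    ... | zero  , c≈a = inj₁ c≈a
    ... | suc m , c≈s = inj₂ (m , c≈s)

    a-involutive : a ∙ a ≈ ε
    a-involutive with S-cover (S-inverse S-a)
    ... | inj₁ a⁻¹≈a        = trans (∙-congˡ (sym a⁻¹≈a)) (inverseʳ a)
    ... | inj₂ (m , a⁻¹≈s) = ⊥-elim (A-disjoint-coset (inv A-a) (coset-resp (sym a⁻¹≈s) (tA-s m)))

    s-involutive : ∀ i → s i ∙ s i ≈ ε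
    s-involutive i = coset-involutive (tA-s i)

    a-s-commute : ∀ i → a ∙ s i ≈ s i ∙ a
    a-s-commute i = involution-centralises-coset A-a a-involutive (tA-s i)

    s-reverse : ∀ i j k → s i ∙ (s j ∙ s k) ≈ s k ∙ (s j ∙ s i)
    s-reverse i j k = coset-reverse (tA-s i) (tA-s j) (tA-s k)

module Tetravalent (G : Group 0ℓ 0ℓ) where
  open Group G renaming (Carrier to X)
  open import Algebra.Properties.Monoid monoid using (cancelˡ)
  open import Relation.Binary.Reasoning.Setoid setoid

  module NoPerfectCode
    (S : X → Set) (S-resp : ∀ {x y} → x ≈ y → S x → S y) (ε∉S : ¬ S ε)
    (a : X) (s : Fin 3 → X) (S-a : S a) (S-s : ∀ i → S (s i))
    (S-cover : ∀ {c} → S c → c ≈ a ⊎ ∃ λ m → c ≈ s m)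
    (a-involutive : a ∙ a ≈ ε) (s-involutive : ∀ i → s i ∙ s i ≈ ε)
    (a-s-commute : ∀ i → a ∙ s i ≈ s i ∙ a)
    (s-reverse : ∀ i j k → s i ∙ (s j ∙ s k) ≈ s k ∙ (s j ∙ s i))
    (a≉s : ∀ i → ¬ a ≈ s i) (s-injective : ∀ {i j} → s i ≈ s j → i ≡ j)
    where
    open CayleyGraph G S S-resp

    s-cancel : ∀ i u → s i ∙ (s i ∙ u) ≈ u
    s-cancel i = cancelˡ (s-involutive i)

    a-cancel : ∀ u → a ∙ (a ∙ u) ≈ u
    a-cancel = cancelˡ a-involutive

    a-s-commute′ : ∀ i u → a ∙ (s i ∙ u) ≈ s i ∙ (a ∙ u)
    a-s-commute′ i u = begin
      a ∙ (s i ∙ u)  ≈⟨ assoc a (s i) u ⟨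
      (a ∙ s i) ∙ u  ≈⟨ ∙-congʳ (a-s-commute i) ⟩
      (s i ∙ a) ∙ u  ≈⟨ assoc (s i) a u ⟩
      s i ∙ (a ∙ u)  ∎

    module _ (C : X → Set) (C-resp : ∀ {x y} → x ≈ y → C x → C y)
             (perfect : IsPerfectCode G S C) (Cε : C ε) where
      open Code C C-resp perfect

      C∪aC : X → Set
      C∪aC u = C u ⊎ C (a ∙ u)

      C∪aC-resp : ∀ {u v} → u ≈ v → C∪aC u → C∪aC v
      C∪aC-resp u≈v (inj₁ Cu)  = inj₁ (C-resp u≈v Cu)
      C∪aC-resp u≈v (inj₂ Cau) = inj₂ (C-resp (∙-congˡ u≈v) Cau)

      C∪aC-unshift : ∀ {u} → C∪aC (a ∙ u) → C∪aC u
      C∪aC-unshift (inj₁ Cau)  = inj₂ Cau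
      C∪aC-unshift (inj₂ Caau) = inj₁ (C-resp (a-cancel _) Caau)

      -- The two mixed cases meet at a common neighbour: u and a sᵢ u are both adjacent to sᵢ u,
      -- and a u and sᵢ u are both adjacent to a sᵢ u.
      C∪aC-independent : ∀ {u} i → C∪aC u → ¬ C∪aC (s i ∙ u)
      C∪aC-independent i (inj₁ Cu) (inj₁ Csu) = code-independent ε∉S Cu (S-s i) Csu
      C∪aC-independent {u} i (inj₁ Cu) (inj₂ Casu) =
        a≉s i (sym (code-unique-neighbour (C-resp (sym (s-cancel i u)) Cu) Casu (S-s i) S-a))
      C∪aC-independent {u} i (inj₂ Cau) (inj₁ Csu) =
        a≉s i (sym (code-unique-neighbour
          (C-resp au≈s[asu] Cau) (C-resp (sym (a-cancel _)) Csu) (S-s i) S-a))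
        where
        au≈s[asu] : a ∙ u ≈ s i ∙ (a ∙ (s i ∙ u))
        au≈s[asu] = begin
          a ∙ u                    ≈⟨ s-cancel i _ ⟨
          s i ∙ (s i ∙ (a ∙ u))    ≈⟨ ∙-congˡ (a-s-commute′ i u) ⟨
          s i ∙ (a ∙ (s i ∙ u))    ∎
      C∪aC-independent {u} i (inj₂ Cau) (inj₂ Casu) =
        code-independent ε∉S Cau (S-s i) (C-resp (a-s-commute′ i u) Casu)

      C∪aC-avoids-s : ∀ i → ¬ C∪aC (s i)
      C∪aC-avoids-s i C∪aC-si = C∪aC-independent i (inj₁ Cε) (C∪aC-resp (sym (identityʳ (s i))) C∪aC-si)

      escape : ∀ {u} → ¬ C∪aC u → ∃ λ m → C (s m ∙ u)
      escape {u} u∉C∪aC with dominated u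
      ... | inj₁ Cu = ⊥-elim (u∉C∪aC (inj₁ Cu))
      ... | inj₂ (c , Sc , Ccu) with S-cover Sc
      ...   | inj₁ c≈a = ⊥-elim (u∉C∪aC (inj₂ (C-resp (∙-congʳ c≈a) Ccu)))
      ...   | inj₂ (m , c≈s) = m , C-resp (∙-congʳ c≈s) Ccu

      partner : ∀ i → ∃ λ k → k ≢ i × C (a ∙ (s k ∙ s i))
      partner i with escape (C∪aC-avoids-s i ∘ C∪aC-unshift)
      ... | m , C[s-a-s] with m ≟ i
      ...   | no m≢i = m , m≢i , C-resp (sym (a-s-commute′ m (s i))) C[s-a-s]
      ...   | yes ≡.refl = ⊥-elim (code-independent ε∉S Cε S-a (C-resp s[as]≈a C[s-a-s]))
        where
        s[as]≈a : s i ∙ (a ∙ s i) ≈ a ∙ ε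
        s[as]≈a = begin
          s i ∙ (a ∙ s i)  ≈⟨ ∙-congˡ (a-s-commute i) ⟩
          s i ∙ (s i ∙ a)  ≈⟨ s-cancel i a ⟩
          a                ≈⟨ identityʳ a ⟨
          a ∙ ε            ∎

      module _ {i k j} (k≢i : k ≢ i) (j≢k : j ≢ k) (j≢i : j ≢ i)
               (C-ik : C (a ∙ (s k ∙ s i))) (C-kj : C (a ∙ (s j ∙ s k))) where
        v : X
        v = s j ∙ s i

        v∉C : ¬ C v
        v∉C Cv = j≢i (s-injective (code-unique-neighbour
          Cv (C-resp (sym (s-involutive i)) Cε) (S-s j) (S-s i)))

        av∉C : ¬ C (a ∙ v)
        av∉C Cav = j≢k (s-injective (code-unique-neighbour
          (C-resp (a-s-commute′ j (s i)) Cav) (C-resp (a-s-commute′ k (s i)) C-ik) (S-s j) (S-s k)))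

        v∉C∪aC : ¬ C∪aC v
        v∉C∪aC = [ v∉C , av∉C ]

        step-toward-k : ∀ m → C∪aC (s m ∙ v) → C∪aC (s k ∙ v) ⊎ m ≡ i
        step-toward-k m C∪aC-smv with Fin3-cover i k j m k≢i j≢k j≢i
        ... | inj₁ m≡i = inj₂ m≡i
        ... | inj₂ (inj₁ ≡.refl) = inj₁ C∪aC-smv
        ... | inj₂ (inj₂ ≡.refl) = ⊥-elim (C∪aC-avoids-s i (C∪aC-resp (s-cancel j (s i)) C∪aC-smv))

        -- v and a v are dominated through s-edges only; the j-edge leads to sᵢ and two i-edges
        -- would make sᵢ v and a sᵢ v adjacent codewords.
        skv∈C∪aC : C∪aC (s k ∙ v)
        skv∈C∪aC
          with m₁ , C-m₁ ← escape v∉C∪aC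
             | m₂ , C-m₂ ← escape (v∉C∪aC ∘ C∪aC-unshift)
          with step-toward-k m₁ (inj₁ C-m₁)
             | step-toward-k m₂ (inj₂ (C-resp (sym (a-s-commute′ m₂ v)) C-m₂))
        ... | inj₁ C∪aC-skv | _ = C∪aC-skv
        ... | inj₂ _ | inj₁ C∪aC-skv = C∪aC-skv
        ... | inj₂ ≡.refl | inj₂ ≡.refl =
          ⊥-elim (code-independent ε∉S C-m₁ S-a (C-resp (sym (a-s-commute′ i v)) C-m₂))

        path-impossible : ⊥
        path-impossible = C∪aC-independent i skv∈C∪aC (C∪aC-resp (sym si[skv]≈sjsk) (inj₂ C-kj))
          where
          si[skv]≈sjsk : s i ∙ (s k ∙ v) ≈ s j ∙ s k
          si[skv]≈sjsk = begin
            s i ∙ (s k ∙ (s j ∙ s i))  ≈⟨ ∙-congˡ (s-reverse k j i) ⟩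
            s i ∙ (s i ∙ (s j ∙ s k))  ≈⟨ s-cancel i _ ⟩
            s j ∙ s k                  ∎

      no-code-through-ε : ⊥
      no-code-through-ε with _ , _ , _ , k≢i , j≢k , j≢i , C-ik , C-kj ← Fin3-path partner =
        path-impossible k≢i j≢k j≢i C-ik C-kj

    no-perfect-code : ¬ Σ (X → Set) λ D → IsPerfectCode G S D
    no-perfect-code (D , perfect) with d , (Dd , _) , _ ← perfect ε =
      no-code-through-ε (Translate D d) translate-resp (translate-perfect perfect d)
        (d , Dd , sym (identityˡ d))

lemma2p2 : (G : Group 0ℓ 0ℓ) (A : Group.Carrier G → Set) (t : Group.Carrier G)
    → IsFinite G
    → IsGenDihedral G A t
    → (S : Group.Carrier G → Set)
    → (∀ {x y} → Group._≈_ G x y → S x → S y)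
    → ¬ S (Group.ε G)
    → InverseClosed G S
    → HasSize G S 4
    → Connected G S
    → HasSize G (_∩_ G S (Coset G t A)) 3
    → ¬ (Σ (Group.Carrier G → Set) λ D → IsPerfectCode G S D)
lemma2p2 G A t _ dihedral S S-resp ε∉S S-inverse S-size _ S∩tA-size =
  no-perfect-code S S-resp ε∉S a s S-a S-s S-cover
    a-involutive s-involutive a-s-commute s-reverse a≉s s-injective
  where
  open GenDihedral G A t dihedral
  open ConnectionSet S S-inverse S-size S∩tA-size
  open Tetravalent.NoPerfectCode G
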